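{- Let $G=(V,E)$ be a finite simple connected graph that contains at least one $t$-tuplet, and let $T(G)$ be the largest $t$ such that $G$ contains a $t$-tuplet. Then $IDI(G)\ge T(G)$.
   Context: A set $S\subseteq V$ with $|S|=t\ge 2$ is a $t$-tuplet if either $S$ is an independent set and any two vertices of $S$ have the same neighborhood, or $S$ is a clique and any two vertices of $S$ have the same closed neighborhood $N(v)\cup\{v\}$. For $G$ of diameter $d$ and $f:V\to\mathbb{R}$, the string of $v$ under $f$ is the $d$-vector whose $i$-th coordinate is $\sum_{w:\ d(v,w)=i} f(w)$ ($d(\cdot,\cdot)$ = graph distance). $IDI(G)$ is the minimum $k$ such that some $f:V\to\mathbb{R}$ with $|f(V)|=k$ gives all vertices pairwise distinct strings. -}

module Defs where

open import Level using (Level)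
open import Data.Nat using (ℕ; zero; suc; _≤_)
open import Data.Fin using (Fin; toℕ) renaming (zero to fzero; suc to fsuc)
open import Data.Fin.Properties using () renaming (_≟_ to _≟ᶠ_)
open import Data.Bool using (Bool; true; false; _∧_; _∨_; not; if_then_else_)
open import Data.Product using (Σ; ∃; _×_; _,_; proj₁)
open import Data.Sum using (_⊎_)
open import Relation.Nullary using (¬_)
open import Relation.Nullary.Decidable using (⌊_⌋)
open import Relation.Binary.PropositionalEquality using (_≡_; _≢_)
open import Algebra.Bundles using (CommutativeRing)

record Graph (n : ℕ) : Set where
  field
    adj   : Fin n → Fin n → Bool
    sym   : ∀ u v → adj u v ≡ adj v u
    irrefl : ∀ v → adj v v ≡ false
open Graph public

anyFin : ∀ {n} → (Fin n → Bool) → Bool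
anyFin {zero}  p = false
anyFin {suc n} p = p fzero ∨ anyFin (λ i → p (fsuc i))

-- within G k v w = true iff d(v,w) ≤ k (there is a walk of length ≤ k)
within : ∀ {n} → Graph n → ℕ → Fin n → Fin n → Bool
within G zero    v w = ⌊ v ≟ᶠ w ⌋
within G (suc k) v w = within G k v w ∨ anyFin (λ u → within G k v u ∧ adj G u w)

distAt : ∀ {n} → Graph n → ℕ → Fin n → Fin n → Bool
distAt G zero    v w = within G zero v w
distAt G (suc i) v w = within G (suc i) v w ∧ not (within G i v w)

Connected : ∀ {n} → Graph n → Set
Connected G = ∀ v w → ∃ λ k → within G k v w ≡ true

IsDiameter : ∀ {n} → Graph n → ℕ → Set
IsDiameter G d = (∀ v w → within G d v w ≡ true) × ∃ λ v → ∃ λ w → distAt G d v w ≡ true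

-- t-tuplet: t ≥ 2 distinct vertices s(0..t-1), either an independent set of
-- vertices with equal open neighbourhoods, or a clique of vertices with equal
-- closed neighbourhoods.
closedAdj : ∀ {n} → Graph n → Fin n → Fin n → Bool
closedAdj G u w = ⌊ u ≟ᶠ w ⌋ ∨ adj G u w

IsTuplet : ∀ {n} → Graph n → (t : ℕ) → (Fin t → Fin n) → Set
IsTuplet G t s =
  2 ≤ t × (∀ i j → s i ≡ s j → i ≡ j) ×
  ( ((∀ i j → adj G (s i) (s j) ≡ false) × (∀ i j w → adj G (s i) w ≡ adj G (s j) w))
  ⊎ ((∀ i j → i ≢ j → adj G (s i) (s j) ≡ true) × (∀ i j w → closedAdj G (s i) w ≡ closedAdj G (s j) w)))

HasTuplet : ∀ {n} → Graph n → ℕ → Set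
HasTuplet {n} G t = Σ (Fin t → Fin n) λ s → IsTuplet G t s

IsMaxTuplet : ∀ {n} → Graph n → ℕ → Set
IsMaxTuplet G T = HasTuplet G T × (∀ t → HasTuplet G t → t ≤ T)

module Labels {c ℓ : Level} (R : CommutativeRing c ℓ) where
  open CommutativeRing R renaming (Carrier to C)

  sumFin : ∀ {n} → (Fin n → C) → C
  sumFin {zero}  g = 0#
  sumFin {suc n} g = g fzero + sumFin (λ i → g (fsuc i))

  -- i-th coordinate (i ≥ 1) of the string of v under f
  coord : ∀ {n} → Graph n → (Fin n → C) → ℕ → Fin n → C
  coord G f i v = sumFin (λ w → if distAt G i v w then f w else 0#)

  string : ∀ {n} → Graph n → (d : ℕ) → (Fin n → C) → Fin n → Fin d → C
  string G d f v j = coord G f (suc (toℕ j)) v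

  SameString : ∀ {n} → Graph n → ℕ → (Fin n → C) → Fin n → Fin n → Set ℓ
  SameString G d f u v = (j : Fin d) → string G d f u j ≈ string G d f v j

  Resolving : ∀ {n} → Graph n → ℕ → (Fin n → C) → Set ℓ
  Resolving G d f = ∀ u v → SameString G d f u v → u ≡ v

  Image : ∀ {n} → (Fin n → C) → Set (c Level.⊔ ℓ)
  Image f = Σ C λ r → ∃ λ v → f v ≈ r

  ImageCard : ∀ {n} → (Fin n → C) → ℕ → Set (c Level.⊔ ℓ)
  ImageCard f k =
    Σ (Fin k → Image f) λ to → Σ (Image f → Fin k) λ from →
      (∀ x y → proj₁ x ≈ proj₁ y → from x ≡ from y) ×
      (∀ i → from (to i) ≡ i) ×
      (∀ x → proj₁ (to (from x)) ≈ proj₁ x)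

  IsIDI : ∀ {n} → Graph n → ℕ → ℕ → Set (c Level.⊔ ℓ)
  IsIDI {n} G d k =
    (Σ (Fin n → C) λ f → Resolving G d f × ImageCard f k) ×
    (∀ (f : Fin n → C) m → Resolving G d f → ImageCard f m → k ≤ m)

{-# OPTIONS --safe #-}
-- Any two members u, v of a tuplet are twins: their adjacencies agree outside {u, v}. Hence the
-- transposition (u v) is a graph automorphism and preserves distances, so if f u = f v it maps
-- the vertices at distance i from u, with their labels, onto those at distance i from v, and u, v
-- get the same string. A resolving labelling is therefore injective on a tuplet, and |f(V)| is at
-- least its size.
module Submission where

open import Defs hiding (sym)
open import Level using (Level)
open import Algebra.Bundles using (CommutativeRing)
open import Data.Nat using (ℕ; _≤_; zero; suc)
open import Data.Bool using (Bool; true; false; _∧_; _∨_; not; if_then_else_)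
open import Data.Bool.Properties using (⇔→≡; ∨-zeroʳ)
open import Data.Fin using (Fin; toℕ) renaming (zero to fzero; suc to fsuc)
open import Data.Fin.Properties using (injective⇒≤) renaming (_≟_ to _≟ᶠ_)
open import Data.Fin.Permutation as Perm using (Permutation′; _⟨$⟩ʳ_; _⟨$⟩ˡ_)
import Data.Fin.Permutation.Components as PC
open import Data.Product using (∃; _,_; proj₁)
open import Data.Sum using (inj₁; inj₂)
open import Function using (_∘_; mk⇔)
open import Function.Definitions using (Injective)
open import Function.Bundles using (Injection)
open import Function.Properties.Inverse using (↔⇒↣)
open import Data.Empty using (⊥-elim)
open import Relation.Nullary using (yes; no)
open import Relation.Nullary.Decidable using (dec-true; dec-false)
open import Relation.Binary.PropositionalEquality
  using (_≡_; _≢_; refl; sym; trans; cong; cong₂; subst)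

anyFin-intro : ∀ {n} (p : Fin n → Bool) (u : Fin n) → p u ≡ true → anyFin p ≡ true
anyFin-intro p fzero    pu rewrite pu = refl
anyFin-intro p (fsuc u) pu rewrite anyFin-intro (p ∘ fsuc) u pu = ∨-zeroʳ (p fzero)

anyFin-elim : ∀ {n} (p : Fin n → Bool) → anyFin p ≡ true → ∃ λ u → p u ≡ true
anyFin-elim {zero}  p ()
anyFin-elim {suc n} p any with p fzero in p0
... | true  = fzero , p0
... | false = let u , pu = anyFin-elim (p ∘ fsuc) any in fsuc u , pu

anyFin-permute : ∀ {n} (π : Permutation′ n) (p q : Fin n → Bool) →
  (∀ u → p (π ⟨$⟩ʳ u) ≡ q u) → anyFin p ≡ anyFin q
anyFin-permute π p q pπ≗q = ⇔→≡ (mk⇔ p⇒q q⇒p)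
  where
  p⇒q : anyFin p ≡ true → anyFin q ≡ true
  p⇒q any with anyFin-elim p any
  ... | u , pu = anyFin-intro q (π ⟨$⟩ˡ u)
    (trans (sym (pπ≗q (π ⟨$⟩ˡ u))) (subst (λ x → p x ≡ true) (sym (Perm.inverseʳ π)) pu))
  q⇒p : anyFin q ≡ true → anyFin p ≡ true
  q⇒p any with anyFin-elim q any
  ... | u , qu = anyFin-intro p (π ⟨$⟩ʳ u) (trans (pπ≗q u) qu)

IsAutomorphism : ∀ {n} → Graph n → Permutation′ n → Set
IsAutomorphism G π = ∀ u w → adj G (π ⟨$⟩ʳ u) (π ⟨$⟩ʳ w) ≡ adj G u w

module _ {n} (G : Graph n) (π : Permutation′ n) (aut : IsAutomorphism G π) where

  within-automorphism : ∀ k v w → within G k (π ⟨$⟩ʳ v) (π ⟨$⟩ʳ w) ≡ within G k v w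
  within-automorphism zero v w with v ≟ᶠ w | π ⟨$⟩ʳ v ≟ᶠ π ⟨$⟩ʳ w
  ... | yes _    | yes _      = refl
  ... | no _     | no _       = refl
  ... | yes refl | no πv≢πv   = ⊥-elim (πv≢πv refl)
  ... | no v≢w   | yes πv≡πw  = ⊥-elim (v≢w (Injection.injective (↔⇒↣ π) πv≡πw))
  within-automorphism (suc k) v w = cong₂ _∨_ (within-automorphism k v w)
    (anyFin-permute π _ _ λ u → cong₂ _∧_ (within-automorphism k v u) (aut u w))

  distAt-automorphism : ∀ i v w → distAt G i (π ⟨$⟩ʳ v) (π ⟨$⟩ʳ w) ≡ distAt G i v w
  distAt-automorphism zero    v w = within-automorphism zero v w
  distAt-automorphism (suc i) v w =
    cong₂ _∧_ (within-automorphism (suc i) v w) (cong not (within-automorphism i v w))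

Twins : ∀ {n} → Graph n → Fin n → Fin n → Set
Twins G u v = ∀ z → z ≢ u → z ≢ v → adj G u z ≡ adj G v z

data TransposeView {n} (u v : Fin n) : Fin n → Set where
  at-u  : PC.transpose u v u ≡ v → TransposeView u v u
  at-v  : PC.transpose u v v ≡ u → TransposeView u v v
  other : ∀ {y} → y ≢ u → y ≢ v → PC.transpose u v y ≡ y → TransposeView u v y

transpose-matchˡ : ∀ {n} (u v : Fin n) → PC.transpose u v u ≡ v
transpose-matchˡ u v rewrite dec-true (u ≟ᶠ u) refl = refl

transpose-matchʳ : ∀ {n} (u v : Fin n) → v ≢ u → PC.transpose u v v ≡ u
transpose-matchʳ u v v≢u rewrite dec-false (v ≟ᶠ u) v≢u | dec-true (v ≟ᶠ v) refl = refl

transpose-mismatch : ∀ {n} (u v y : Fin n) → y ≢ u → y ≢ v → PC.transpose u v y ≡ y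
transpose-mismatch u v y y≢u y≢v rewrite dec-false (y ≟ᶠ u) y≢u | dec-false (y ≟ᶠ v) y≢v = refl

transposeView : ∀ {n} (u v y : Fin n) → TransposeView u v y
transposeView u v y with y ≟ᶠ u
... | yes refl = at-u (transpose-matchˡ u v)
... | no y≢u with y ≟ᶠ v
...   | yes refl = at-v (transpose-matchʳ u y y≢u)
...   | no y≢v   = other y≢u y≢v (transpose-mismatch u v y y≢u y≢v)

transpose-automorphism : ∀ {n} (G : Graph n) {u v : Fin n} → Twins G u v →
  IsAutomorphism G (Perm.transpose u v)
transpose-automorphism G {u} {v} twins y w with transposeView u v y | transposeView u v w
... | at-u τy | at-u τw rewrite τy | τw = trans (irrefl G v) (sym (irrefl G u))
... | at-u τy | at-v τw rewrite τy | τw = Graph.sym G v u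
... | at-u τy | other w≢u w≢v τw rewrite τy | τw = sym (twins w w≢u w≢v)
... | at-v τy | at-u τw rewrite τy | τw = Graph.sym G u v
... | at-v τy | at-v τw rewrite τy | τw = trans (irrefl G u) (sym (irrefl G v))
... | at-v τy | other w≢u w≢v τw rewrite τy | τw = twins w w≢u w≢v
... | other y≢u y≢v τy | at-u τw rewrite τy | τw =
  trans (Graph.sym G y v) (trans (sym (twins y y≢u y≢v)) (Graph.sym G u y))
... | other y≢u y≢v τy | at-v τw rewrite τy | τw =
  trans (Graph.sym G y u) (trans (twins y y≢u y≢v) (Graph.sym G v y))
... | other _ _ τy | other _ _ τw rewrite τy | τw = refl

tuplet-twins : ∀ {n} (G : Graph n) {t} {s : Fin t → Fin n} → IsTuplet G t s →
  ∀ i j → Twins G (s i) (s j)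
tuplet-twins G (_ , _ , inj₁ (_ , sameN)) i j z _ _ = sameN i j z
tuplet-twins G {s = s} (_ , _ , inj₂ (_ , sameClosedN)) i j z z≢si z≢sj
  with s i ≟ᶠ z | s j ≟ᶠ z | sameClosedN i j z
... | yes si≡z | _        | _  = ⊥-elim (z≢si (sym si≡z))
... | no _     | yes sj≡z | _  = ⊥-elim (z≢sj (sym sj≡z))
... | no _     | no _     | eq = eq

module _ {c ℓ} (R : CommutativeRing c ℓ) where
  open CommutativeRing R renaming (Carrier to C; refl to ≈-refl; sym to ≈-sym)
  open Labels R
  open import Algebra.Properties.CommutativeMonoid.Sum +-commutativeMonoid
    using (sum; sum-permute; sum-cong-≋)
  open import Relation.Binary.Reasoning.Setoid setoid

  sumFin≡sum : ∀ {n} (g : Fin n → C) → sumFin g ≡ sum g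
  sumFin≡sum {zero}  g = refl
  sumFin≡sum {suc n} g = cong (g fzero +_) (sumFin≡sum (g ∘ fsuc))

  coord-automorphism : ∀ {n} (G : Graph n) (π : Permutation′ n) → IsAutomorphism G π →
    (f : Fin n → C) → (∀ w → f (π ⟨$⟩ʳ w) ≈ f w) → ∀ i v → coord G f i (π ⟨$⟩ʳ v) ≈ coord G f i v
  coord-automorphism G π aut f fπ≈f i v = begin
    coord G f i (π ⟨$⟩ʳ v)              ≡⟨ sumFin≡sum (shell (π ⟨$⟩ʳ v)) ⟩
    sum (shell (π ⟨$⟩ʳ v))              ≈⟨ sum-permute (shell (π ⟨$⟩ʳ v)) π ⟩
    sum (shell (π ⟨$⟩ʳ v) ∘ (π ⟨$⟩ʳ_))  ≈⟨ sum-cong-≋ shell-automorphism ⟩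
    sum (shell v)                       ≡⟨ sumFin≡sum (shell v) ⟨
    coord G f i v                       ∎
    where
    shell : Fin _ → Fin _ → C
    shell x w = if distAt G i x w then f w else 0#
    shell-automorphism : ∀ w → shell (π ⟨$⟩ʳ v) (π ⟨$⟩ʳ w) ≈ shell v w
    shell-automorphism w rewrite distAt-automorphism G π aut i v w with distAt G i v w
    ... | true  = fπ≈f w
    ... | false = ≈-refl

  transpose-preserves-labels : ∀ {n} (f : Fin n → C) {u v : Fin n} → f u ≈ f v →
    ∀ w → f (Perm.transpose u v ⟨$⟩ʳ w) ≈ f w
  transpose-preserves-labels f {u} {v} fu≈fv w with transposeView u v w
  ... | at-u τw      rewrite τw = ≈-sym fu≈fv
  ... | at-v τw      rewrite τw = fu≈fv
  ... | other _ _ τw rewrite τw = ≈-refl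

  twins-sameString : ∀ {n} (G : Graph n) {u v : Fin n} → Twins G u v →
    (d : ℕ) (f : Fin n → C) → f u ≈ f v → SameString G d f u v
  twins-sameString G {u} {v} twins d f fu≈fv j = begin
    coord G f i u          ≈⟨ coord-automorphism G τ τ-aut f τ-labels i u ⟨
    coord G f i (τ ⟨$⟩ʳ u) ≡⟨ cong (coord G f i) (transpose-matchˡ u v) ⟩
    coord G f i v          ∎
    where
    i = suc (toℕ j)
    τ = Perm.transpose u v
    τ-aut = transpose-automorphism G twins
    τ-labels = transpose-preserves-labels f fu≈fv

  resolving-injective-on-tuplet : ∀ {n} (G : Graph n) (d : ℕ) {f : Fin n → C} → Resolving G d f →
    ∀ {t} {s : Fin t → Fin n} → IsTuplet G t s → Injective _≡_ _≈_ (f ∘ s)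
  resolving-injective-on-tuplet G d {f} resolving {s = s} tuplet@(_ , s-injective , _)
    {i} {j} fsi≈fsj =
    s-injective i j (resolving (s i) (s j)
      (twins-sameString G (tuplet-twins G tuplet i j) d f fsi≈fsj))

  ImageCard-injective⇒≤ : ∀ {n} {f : Fin n → C} {k} → ImageCard f k →
    ∀ {t} (s : Fin t → Fin n) → Injective _≡_ _≈_ (f ∘ s) → t ≤ k
  ImageCard-injective⇒≤ {f = f} (to , from , _ , _ , to∘from≈) s fs-injective =
    injective⇒≤ λ {i} {j} eq → fs-injective (begin
      f (s i)                         ≈⟨ to∘from≈ (image (s i)) ⟨
      proj₁ (to (from (image (s i)))) ≡⟨ cong (proj₁ ∘ to) eq ⟩
      proj₁ (to (from (image (s j)))) ≈⟨ to∘from≈ (image (s j)) ⟩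
      f (s j)                         ∎)
    where
    image : ∀ w → Image f
    image w = f w , w , ≈-refl

theorem3 : ∀ {c ℓ : Level} (R : CommutativeRing c ℓ) {n : ℕ} (G : Graph n) →
    Connected G → (d : ℕ) → IsDiameter G d →
    (T : ℕ) → IsMaxTuplet G T →
    (k : ℕ) → Labels.IsIDI R G d k → T ≤ k
theorem3 R G _ d _ T ((s , tuplet) , _) k ((f , resolving , imageCard) , _) =
  ImageCard-injective⇒≤ R imageCard s (resolving-injective-on-tuplet R G d resolving tuplet)
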